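{- Let $S$ be a finite set of sequents in the language of $\mathbf{ACT}_\omega$. For each sequent $A_1,\ldots,A_n\Rightarrow B$ in $S$ consider the formula $(A_1\cdot\ldots\cdot A_n)\backslash B$ if $n\ge1$, and the formula $B$ if $n=0$; let $\Upsilon_S$ be a sequence consisting of all these formulas in an arbitrary order, and let $!\Upsilon_S$ be the sequence obtained by prefixing $!$ to each of them. Then for every sequent $\Pi\Rightarrow C$ of $\mathbf{ACT}_\omega$: $\Pi\Rightarrow C$ is derivable in $\mathbf{ACT}_\omega$ from $S$ if and only if $!\Upsilon_S,\Pi\Rightarrow C$ is derivable in $!\mathbf{ACT}_\omega$ (without hypotheses).
   Context: Formulas of $!\mathbf{ACT}_\omega$ are built from a countable set of variables and constants $0,1$ using binary $\backslash$, $/$, $\cdot$, $\oplus$, $\&$, unary postfix ${}^*$ and unary prefix $!$; formulas without $!$ are the formulas of $\mathbf{ACT}_\omega$. A sequent is $\Pi\Rightarrow B$ ($\Pi$ a finite, possibly empty, sequence of formulas); $A^n$ is $n$ copies of $A$; $!\Pi$ is a sequence of formulas of the form $!A$. $\mathbf{ACT}_\omega$ has axioms $A\Rightarrow A$, $\ \Rightarrow1$, $\ \Gamma,0,\Delta\Rightarrow C$, $\ \Rightarrow A^*$ and rules (premises / conclusion): ($\backslash L$) $\Pi\Rightarrow A$, $\Gamma,B,\Delta\Rightarrow C$ / $\Gamma,\Pi,A\backslash B,\Delta\Rightarrow C$; ($\backslash R$) $A,\Pi\Rightarrow B$ / $\Pi\Rightarrow A\backslash B$; ($/L$) $\Pi\Rightarrow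 A$, $\Gamma,B,\Delta\Rightarrow C$ / $\Gamma,B/A,\Pi,\Delta\Rightarrow C$; ($/R$) $\Pi,A\Rightarrow B$ / $\Pi\Rightarrow B/A$; ($\cdot L$) $\Gamma,A,B,\Delta\Rightarrow C$ / $\Gamma,A\cdot B,\Delta\Rightarrow C$; ($\cdot R$) $\Gamma\Rightarrow A$, $\Delta\Rightarrow B$ / $\Gamma,\Delta\Rightarrow A\cdot B$; ($1L$) $\Gamma,\Delta\Rightarrow C$ / $\Gamma,1,\Delta\Rightarrow C$; ($\oplus L$) $\Gamma,A_1,\Delta\Rightarrow C$, $\Gamma,A_2,\Delta\Rightarrow C$ / $\Gamma,A_1\oplus A_2,\Delta\Rightarrow C$; ($\oplus R_i$) $\Pi\Rightarrow A_i$ / $\Pi\Rightarrow A_1\oplus A_2$; ($\&L_i$) $\Gamma,A_i,\Delta\Rightarrow C$ / $\Gamma,A_1\&A_2,\Delta\Rightarrow C$; ($\&R$) $\Pi\Rightarrow A_1$, $\Pi\Rightarrow A_2$ / $\Pi\Rightarrow A_1\&A_2$; (${}^*L_\omega$) $(\Gamma,A^n,\Delta\Rightarrow C)_{n\in\omega}$ / $\Gamma,A^*,\Delta\Rightarrow C$; (${}^*R_n$, $n\ge1$) $\Pi_1\Rightarrow A,\dots,\Pi_n\Rightarrow A$ / $\Pi_1,\dots,\Pi_n\Rightarrow A^*$; (Cut) $\Pi\Rightarrow A$, $\Gamma,A,\Delta\Rightarrow C$ / $\Gamma,\Pi,\Delta\Rightarrow C$. $!\mathbf{ACT}_\omega$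 has in addition: ($!L$) $\Gamma,A,\Delta\Rightarrow C$ / $\Gamma,!A,\Delta\Rightarrow C$; ($!R$) $!\Pi\Rightarrow B$ / $!\Pi\Rightarrow!B$; ($!P_1$) $\Gamma,\Pi,!A,\Delta\Rightarrow C$ / $\Gamma,!A,\Pi,\Delta\Rightarrow C$; ($!P_2$) $\Gamma,!A,\Pi,\Delta\Rightarrow C$ / $\Gamma,\Pi,!A,\Delta\Rightarrow C$; ($!W$) $\Gamma,\Delta\Rightarrow C$ / $\Gamma,!A,\Delta\Rightarrow C$; ($!C$) $\Gamma,!A,!A,\Delta\Rightarrow C$ / $\Gamma,!A,\Delta\Rightarrow C$. Sequents derivable from a set of hypotheses $S$ form the least set containing the axioms and the members of $S$ and closed under the rules (derivations are well-founded, possibly infinite trees). -}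

module Defs where

open import Data.Bool using (Bool; true; false)
open import Data.Nat using (ℕ)
open import Data.List using (List; []; _∷_; _++_; map; replicate; concat)
open import Data.List.Relation.Unary.All using (All)
open import Data.List.Membership.Propositional using (_∈_)
open import Data.Product using (_×_; _,_)

infixr 30 _·_
infixr 25 _⊕_ _&_
infixr 20 _╲_
infixl 20 _╱_
infix 40 _*
infix 45 !_

-- Formulas. The index b says whether ! may occur:
-- Fm false = formulas of ACT_ω, Fm true = formulas of !ACT_ω.
data Fm : Bool → Set where
  var  : ∀ {b} → ℕ → Fm b
  𝟘 𝟙  : ∀ {b} → Fm b
  _╲_  : ∀ {b} → Fm b → Fm b → Fm b
  _╱_  : ∀ {b} → Fm b → Fm b → Fm b
  _·_  : ∀ {b} → Fm b → Fm b → Fm b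
  _⊕_  : ∀ {b} → Fm b → Fm b → Fm b
  _&_  : ∀ {b} → Fm b → Fm b → Fm b
  _*   : ∀ {b} → Fm b → Fm b
  !_   : Fm true → Fm true

record Seq (b : Bool) : Set where
  constructor _⇒_
  field
    ant : List (Fm b)
    suc : Fm b

-- Der b S Π C : "Π ⇒ C is derivable from S"
-- in ACT_ω (b = false) or in !ACT_ω (b = true; the ! rules only exist there).
data Der : (b : Bool) → List (Seq b) → List (Fm b) → Fm b → Set where
  hyp  : ∀ {b S Π C} → (Π ⇒ C) ∈ S → Der b S Π C
  ax   : ∀ {b S A} → Der b S (A ∷ []) A
  𝟙R   : ∀ {b S} → Der b S [] 𝟙
  𝟘L   : ∀ {b S Γ Δ C} → Der b S (Γ ++ 𝟘 ∷ Δ) C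
  *R₀  : ∀ {b S A} → Der b S [] (A *)
  ╲L   : ∀ {b S Π Γ Δ A B C} → Der b S Π A → Der b S (Γ ++ B ∷ Δ) C →
         Der b S (Γ ++ Π ++ (A ╲ B) ∷ Δ) C
  ╲R   : ∀ {b S Π A B} → Der b S (A ∷ Π) B → Der b S Π (A ╲ B)
  ╱L   : ∀ {b S Π Γ Δ A B C} → Der b S Π A → Der b S (Γ ++ B ∷ Δ) C →
         Der b S (Γ ++ (B ╱ A) ∷ Π ++ Δ) C
  ╱R   : ∀ {b S Π A B} → Der b S (Π ++ A ∷ []) B → Der b S Π (B ╱ A)
  ·L   : ∀ {b S Γ Δ A B C} → Der b S (Γ ++ A ∷ B ∷ Δ) C → Der b S (Γ ++ (A · B) ∷ Δ) C
  ·R   : ∀ {b S Γ Δ A B} → Der b S Γ A → Der b S Δ B → Der b S (Γ ++ Δ) (A · B)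
  𝟙L   : ∀ {b S Γ Δ C} → Der b S (Γ ++ Δ) C → Der b S (Γ ++ 𝟙 ∷ Δ) C
  ⊕L   : ∀ {b S Γ Δ A₁ A₂ C} → Der b S (Γ ++ A₁ ∷ Δ) C → Der b S (Γ ++ A₂ ∷ Δ) C →
         Der b S (Γ ++ (A₁ ⊕ A₂) ∷ Δ) C
  ⊕R₁  : ∀ {b S Π A₁ A₂} → Der b S Π A₁ → Der b S Π (A₁ ⊕ A₂)
  ⊕R₂  : ∀ {b S Π A₁ A₂} → Der b S Π A₂ → Der b S Π (A₁ ⊕ A₂)
  &L₁  : ∀ {b S Γ Δ A₁ A₂ C} → Der b S (Γ ++ A₁ ∷ Δ) C → Der b S (Γ ++ (A₁ & A₂) ∷ Δ) C
  &L₂  : ∀ {b S Γ Δ A₁ A₂ C} → Der b S (Γ ++ A₂ ∷ Δ) C → Der b S (Γ ++ (A₁ & A₂) ∷ Δ) C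
  &R   : ∀ {b S Π A₁ A₂} → Der b S Π A₁ → Der b S Π A₂ → Der b S Π (A₁ & A₂)
  *Lω  : ∀ {b S Γ Δ A C} → ((n : ℕ) → Der b S (Γ ++ replicate n A ++ Δ) C) →
         Der b S (Γ ++ (A *) ∷ Δ) C
  -- *R_n (n ≥ 1): premises Π₁ ⇒ A, …, Π_n ⇒ A, conclusion Π₁,…,Π_n ⇒ A*
  *Rₙ  : ∀ {b S A} (Π₁ : List (Fm b)) (Πs : List (List (Fm b))) →
         Der b S Π₁ A → All (λ Π → Der b S Π A) Πs →
         Der b S (Π₁ ++ concat Πs) (A *)
  cut  : ∀ {b S Π Γ Δ A C} → Der b S Π A → Der b S (Γ ++ A ∷ Δ) C → Der b S (Γ ++ Π ++ Δ) C
  !L   : ∀ {S Γ Δ A C} → Der true S (Γ ++ A ∷ Δ) C → Der true S (Γ ++ ! A ∷ Δ) C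
  !R   : ∀ {S Γ B} → Der true S (map !_ Γ) B → Der true S (map !_ Γ) (! B)
  !P₁  : ∀ {S Γ Π Δ A C} → Der true S (Γ ++ Π ++ ! A ∷ Δ) C →
         Der true S (Γ ++ ! A ∷ Π ++ Δ) C
  !P₂  : ∀ {S Γ Π Δ A C} → Der true S (Γ ++ ! A ∷ Π ++ Δ) C →
         Der true S (Γ ++ Π ++ ! A ∷ Δ) C
  !W   : ∀ {S Γ Δ A C} → Der true S (Γ ++ Δ) C → Der true S (Γ ++ ! A ∷ Δ) C
  !C   : ∀ {S Γ Δ A C} → Der true S (Γ ++ ! A ∷ ! A ∷ Δ) C → Der true S (Γ ++ ! A ∷ Δ) C

emb : Fm false → Fm true
emb (var x) = var x
emb 𝟘 = 𝟘
emb 𝟙 = 𝟙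
emb (A ╲ B) = emb A ╲ emb B
emb (A ╱ B) = emb A ╱ emb B
emb (A · B) = emb A · emb B
emb (A ⊕ B) = emb A ⊕ emb B
emb (A & B) = emb A & emb B
emb (A *) = emb A *

-- A₁ · … · Aₙ for n ≥ 1 (given as first element and the rest), bracketed to the right
prod : ∀ {b} → Fm b → List (Fm b) → Fm b
prod A [] = A
prod A (B ∷ Γ) = A · prod B Γ

υ : ∀ {b} → Seq b → Fm b
υ ([] ⇒ B) = B
υ ((A ∷ Γ) ⇒ B) = prod A Γ ╲ B

Υ : List (Seq false) → List (Fm false)
Υ S = map υ S

-- Forward: prefixing the block !Υ_S to every sequent turns an ACT_ω-derivation from S into a
-- hypothesis-free !ACT_ω-derivation.  The block is weakened in at axioms, appears once in each
-- premise of a branching rule and is contracted back (!P₁/!P₂ let it travel through the context),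
-- and a hypothesis Π ⇒ C follows from its copy !υ in the block by !L and \L.
--
-- Backward: ACT_ω with hypotheses has no cut elimination, so the !-block cannot be removed
-- syntactically.  Instead we use Okada's phase semantics on the free monoid of ACT_ω formulas,
-- with the closure operator induced by derivability from S.  Every !ACT_ω-derivation is sound for
-- it; for a !-free formula A the fact ⟦A⟧ is exactly the set ↓A of words deriving A from S; and
-- each υ in Υ_S is derivable from S, so ⟦!υ⟧ contains the empty word and the block !Υ_S can be
-- interpreted by it, leaving a derivation of Π ⇒ C from S.

module Submission where

open import Defs
open import Data.Bool using (Bool; true; false)
open import Data.Nat using (ℕ; zero; suc)
open import Data.List using (List; []; _∷_; [_]; _++_; map; replicate; concat)
open import Data.List.Properties using (++-assoc; ++-identityʳ; map-++; map-replicate; map-∘; concat-map)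
open import Data.List.Relation.Unary.All as All using (All; []; _∷_; tabulate)
open import Data.List.Relation.Unary.All.Properties using () renaming (map⁺ to All-map⁺)
open import Data.List.Relation.Unary.Any using (here; there)
open import Data.List.Membership.Propositional using (_∈_)
open import Data.List.Membership.Propositional.Properties using (∈-map⁺)
open import Data.Product using (_×_; _,_; ∃-syntax)
open import Data.Sum using (inj₁; inj₂)
open import Function using (const; id)
open import Function.Bundles using (_⇔_; mk⇔)
open import Level using (0ℓ)
open import Relation.Binary.PropositionalEquality using (_≡_; refl; sym; trans; cong; subst)
open import Relation.Unary using (Pred; _⊆_; _∪_; _∩_; ∅; ｛_｝; ⋃)

private
  variable
    b : Bool
    S : List (Seq b)
    T : List (Seq true)
    A C : Fm b
    Γ Δ Θ Π L : List (Fm b)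

cast : Γ ≡ Δ → Der b S Γ C → Der b S Δ C
cast = subst (λ Ξ → Der _ _ Ξ _)

prod-R : Der b S (A ∷ Γ) (prod A Γ)
prod-R {Γ = []} = ax
prod-R {A = A} {Γ = _ ∷ _} = ·R {Γ = [ A ]} ax prod-R

prod-L : ∀ Δ → Der b S (Δ ++ A ∷ Γ ++ Θ) C → Der b S (Δ ++ prod A Γ ∷ Θ) C
prod-L {Γ = []} Δ d = d
prod-L {A = A} {Γ = _ ∷ _} Δ d =
  ·L {Γ = Δ} (cast (++-assoc Δ [ A ] _) (prod-L (Δ ++ [ A ]) (cast (sym (++-assoc Δ [ A ] _)) d)))

υ-R : Der b S Π C → Der b S [] (υ (Π ⇒ C))
υ-R {Π = []} d = d
υ-R {Π = _ ∷ Γ} d = ╲R (prod-L [] (cast (cong (_ ∷_) (sym (++-identityʳ Γ))) d))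

υ-L : Der b S (Π ++ [ υ (Π ⇒ C) ]) C
υ-L {Π = []} = ax
υ-L {Π = _ ∷ _} = ╲L {Γ = []} {Δ = []} prod-R ax

*R : {Πs : List (List (Fm b))} → All (λ Π → Der b S Π A) Πs → Der b S (concat Πs) (A *)
*R [] = *R₀
*R (d ∷ ds) = *Rₙ _ _ d ds

emb-prod : ∀ (A : Fm false) Γ → emb (prod A Γ) ≡ prod (emb A) (map emb Γ)
emb-prod A [] = refl
emb-prod A (B ∷ Γ) = cong (emb A ·_) (emb-prod B Γ)

emb-υ : ∀ Π (C : Fm false) → emb (υ (Π ⇒ C)) ≡ υ (map emb Π ⇒ emb C)
emb-υ [] C = refl
emb-υ (A ∷ Γ) C = cong (_╲ emb C) (emb-prod A Γ)

υ-!L : Der true T (! υ (Π ⇒ C) ∷ Π) C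
υ-!L {Π = Π} {C = C} =
  cast (cong (! υ (Π ⇒ C) ∷_) (++-identityʳ Π)) (!P₁ {Γ = []} {Π = Π} (!L {Γ = Π} {Δ = []} υ-L))

!W-many : ∀ Γ L → Der true T (Γ ++ Δ) C → Der true T (Γ ++ map !_ L ++ Δ) C
!W-many Γ [] d = d
!W-many Γ (_ ∷ L) d = !W {Γ = Γ} (!W-many Γ L d)

!P₁-many : ∀ Γ Π L → Der true T (Γ ++ Π ++ map !_ L ++ Δ) C →
                      Der true T (Γ ++ map !_ L ++ Π ++ Δ) C
!P₁-many Γ Π [] d = d
!P₁-many Γ Π (A ∷ L) d =
  cast (++-assoc Γ _ _)
    (!P₁-many (Γ ++ [ ! A ]) Π L (cast (sym (++-assoc Γ _ _)) (!P₁ {Γ = Γ} {Π = Π} d)))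

!P₂-many : ∀ Γ Π L → Der true T (Γ ++ map !_ L ++ Π ++ Δ) C →
                      Der true T (Γ ++ Π ++ map !_ L ++ Δ) C
!P₂-many Γ Π [] d = d
!P₂-many Γ Π (A ∷ L) d =
  !P₂ {Γ = Γ} {Π = Π} (cast (++-assoc Γ _ _)
    (!P₂-many (Γ ++ [ ! A ]) Π L (cast (sym (++-assoc Γ _ _)) d)))

!C-many : ∀ Γ L → Der true T (Γ ++ map !_ L ++ map !_ L ++ Δ) C →
                   Der true T (Γ ++ map !_ L ++ Δ) C
!C-many Γ [] d = d
!C-many Γ (A ∷ L) d =
  cast (++-assoc Γ _ _) (!C-many (Γ ++ [ ! A ]) L
    (cast (sym (++-assoc Γ _ _)) (!C {Γ = Γ} (!P₁ {Γ = Γ} {Π = ! A ∷ map !_ L} d))))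

!-select : A ∈ L → Der true T (! A ∷ Δ) C → Der true T (map !_ L ++ Δ) C
!-select {L = _ ∷ L} (here refl) d = !W-many [ _ ] L d
!-select (there m) d = !W {Γ = []} (!-select m d)

!-merge : ∀ L Γ → Der true T ((map !_ L ++ Γ) ++ map !_ L ++ Δ) C →
                   Der true T (map !_ L ++ Γ ++ Δ) C
!-merge L Γ d = !C-many [] L (!P₁-many (map !_ L) Γ L (cast (++-assoc (map !_ L) Γ _) d))

!-merge-concat : ∀ L Γ Δs → Der true T ((map !_ L ++ Γ) ++ concat (map (map !_ L ++_) Δs)) C →
                 Der true T (map !_ L ++ Γ ++ concat Δs) C
!-merge-concat L Γ [] d = cast (++-assoc (map !_ L) Γ []) d
!-merge-concat L Γ (Δ ∷ Δs) d =
  cast (cong (map !_ L ++_) (++-assoc Γ Δ _))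
    (!-merge-concat L (Γ ++ Δ) Δs
      (cast (trans (cong (map !_ L ++_) (sym (++-assoc Γ Δ _)))
                   (sym (++-assoc (map !_ L) (Γ ++ Δ) _)))
        (!-merge L Γ (cast (cong ((map !_ L ++ Γ) ++_) (++-assoc (map !_ L) Δ _)) d))))

hyp-from-!Υ : ∀ {S Π C} → (Π ⇒ C) ∈ S →
              Der true T (map !_ (map emb (Υ S)) ++ map emb Π) (emb C)
hyp-from-!Υ {Π = Π} {C} m =
  !-select (∈-map⁺ emb (∈-map⁺ υ m))
    (subst (λ F → Der true _ (! F ∷ map emb Π) (emb C)) (sym (emb-υ Π C)) υ-!L)

module Simulation {S : List (Seq false)} {T : List (Seq true)} (L : List (Fm true))
  (axioms : ∀ {Π C} → (Π ⇒ C) ∈ S → Der true T (map !_ L ++ map emb Π) (emb C)) where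

  private
    U : List (Fm true)
    U = map !_ L

    E : List (Fm false) → List (Fm true)
    E = map emb

    U++E-++ : ∀ Γ Δ → U ++ E (Γ ++ Δ) ≡ (U ++ E Γ) ++ E Δ
    U++E-++ Γ Δ = trans (cong (U ++_) (map-++ emb Γ Δ)) (sym (++-assoc U (E Γ) (E Δ)))

    detach : ∀ Γ {Δ C} → Der true T (U ++ E (Γ ++ Δ)) C →
                         Der true T ((U ++ E Γ) ++ E Δ) C
    detach Γ = cast (U++E-++ Γ _)

    attach : ∀ Γ {Δ C} → Der true T ((U ++ E Γ) ++ E Δ) C →
                         Der true T (U ++ E (Γ ++ Δ)) C
    attach Γ = cast (sym (U++E-++ Γ _))

    merge : ∀ Γ Δ {C} → Der true T ((U ++ E Γ) ++ U ++ E Δ) C →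
                        Der true T (U ++ E (Γ ++ Δ)) C
    merge Γ Δ d = cast (cong (U ++_) (sym (map-++ emb Γ Δ))) (!-merge L (E Γ) d)

    merge-cut : ∀ Γ Π Δ {C} → Der true T ((U ++ E Γ) ++ (U ++ E Π) ++ E Δ) C →
                              Der true T (U ++ E (Γ ++ Π ++ Δ)) C
    merge-cut Γ Π Δ d = merge Γ (Π ++ Δ) (cast (cong ((U ++ E Γ) ++_) (sym (U++E-++ Π Δ))) d)

    E-replicate-++ : ∀ n (A : Fm false) Δ → E (replicate n A ++ Δ) ≡ replicate n (emb A) ++ E Δ
    E-replicate-++ n A Δ =
      trans (map-++ emb (replicate n A) Δ) (cong (_++ E Δ) (map-replicate emb n A))

    E-concat : ∀ Γ Πs → U ++ E Γ ++ concat (map E Πs) ≡ U ++ E (Γ ++ concat Πs)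
    E-concat Γ Πs =
      cong (U ++_) (trans (cong (E Γ ++_) (concat-map Πs)) (sym (map-++ emb Γ (concat Πs))))

  mutual
    embed : ∀ {Π C} → Der false S Π C → Der true T (U ++ E Π) (emb C)
    embed (hyp m) = axioms m
    embed ax = !W-many [] L ax
    embed 𝟙R = !W-many [] L 𝟙R
    embed (𝟘L {Γ = Γ}) = attach Γ 𝟘L
    embed *R₀ = !W-many [] L *R₀
    embed (╲L {Π = Π} {Γ} {Δ} {A} {B} d e) =
      merge-cut Γ Π ((A ╲ B) ∷ Δ) (╲L (embed d) (detach Γ (embed e)))
    embed (╲R {A = A} d) = ╲R (!P₂-many [] [ emb A ] L (embed d))
    embed (╱L {Π = Π} {Γ} {Δ} {A} {B} d e) =
      cast (cong (λ Ξ → U ++ E Ξ) (++-assoc Γ [ B ╱ A ] (Π ++ Δ)))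
        (merge-cut (Γ ++ [ B ╱ A ]) Π Δ
          (cast (trans (sym (++-assoc (U ++ E Γ) _ _)) (cong (_++ _) (sym (U++E-++ Γ [ B ╱ A ]))))
            (╱L {Π = U ++ E Π} (embed d) (detach Γ (embed e)))))
    embed (╱R {Π = Π} d) = ╱R (detach Π (embed d))
    embed (·L {Γ = Γ} d) = attach Γ (·L (detach Γ (embed d)))
    embed (·R {Γ = Γ} {Δ} d e) = merge Γ Δ (·R (embed d) (embed e))
    embed (𝟙L {Γ = Γ} d) = attach Γ (𝟙L (detach Γ (embed d)))
    embed (⊕L {Γ = Γ} d e) = attach Γ (⊕L (detach Γ (embed d)) (detach Γ (embed e)))
    embed (⊕R₁ d) = ⊕R₁ (embed d)
    embed (⊕R₂ d) = ⊕R₂ (embed d)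
    embed (&L₁ {Γ = Γ} d) = attach Γ (&L₁ (detach Γ (embed d)))
    embed (&L₂ {Γ = Γ} d) = attach Γ (&L₂ (detach Γ (embed d)))
    embed (&R d e) = &R (embed d) (embed e)
    embed (*Lω {Γ = Γ} {Δ} {A} f) =
      attach Γ (*Lω λ n →
        cast (cong ((U ++ E Γ) ++_) (E-replicate-++ n A Δ)) (detach Γ (embed (f n))))
    embed (*Rₙ Π₁ Πs d ds) =
      cast (E-concat Π₁ Πs)
        (!-merge-concat L (E Π₁) (map E Πs) (*Rₙ _ _ (embed d) (All-map⁺ (embed-all ds))))
    embed (cut {Π = Π} {Γ} {Δ} d e) = merge-cut Γ Π Δ (cut (embed d) (detach Γ (embed e)))

    embed-all : ∀ {Πs A} → All (λ Π → Der false S Π A) Πs →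
                           All (λ Π → Der true T (U ++ Π) (emb A)) (map E Πs)
    embed-all [] = []
    embed-all (d ∷ ds) = embed d ∷ embed-all ds

module PhaseModel (S : List (Seq false)) where

  Word : Set
  Word = List (Fm false)

  Lang : Set₁
  Lang = Pred Word 0ℓ

  private
    variable
      X Y Z : Lang
      g d : Word
      F G : Fm false

  ↓_ : Fm false → Lang
  ↓ F = λ y → Der false S y F

  Cl : Lang → Lang
  Cl X y = ∀ Γ Δ C → (∀ {x} → X x → Der false S (Γ ++ x ++ Δ) C) →
                      Der false S (Γ ++ y ++ Δ) C

  Closed : Lang → Set
  Closed Z = Cl Z ⊆ Z

  ⊆-Cl : X ⊆ Cl X
  ⊆-Cl p Γ Δ C k = k p

  Cl-mono : X ⊆ Y → Cl X ⊆ Cl Y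
  Cl-mono f p Γ Δ C k = p Γ Δ C (λ q → k (f q))

  Cl-closed : Closed (Cl X)
  Cl-closed p Γ Δ C k = p Γ Δ C (λ q → q Γ Δ C k)

  Cl-least : Closed Z → X ⊆ Z → Cl X ⊆ Z
  Cl-least cZ f p = cZ (Cl-mono f p)

  Closed-ˡ : Closed Z → Closed (λ x → Z (g ++ x))
  Closed-ˡ {g = g} cZ {y} p = cZ λ Γ Δ C k →
    cast (reassoc Γ y Δ)
      (p (Γ ++ g) Δ C λ {x} q → cast (sym (reassoc Γ x Δ)) (k q))
    where
      reassoc : ∀ Γ x Δ → (Γ ++ g) ++ x ++ Δ ≡ Γ ++ (g ++ x) ++ Δ
      reassoc Γ x Δ = trans (++-assoc Γ g _) (cong (Γ ++_) (sym (++-assoc g x Δ)))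

  Closed-ʳ : Closed Z → Closed (λ x → Z (x ++ d))
  Closed-ʳ {d = d} cZ {y} p = cZ λ Γ Δ C k →
    cast (reassoc Γ y Δ)
      (p Γ (d ++ Δ) C λ {x} q → cast (sym (reassoc Γ x Δ)) (k q))
    where
      reassoc : ∀ Γ x Δ → Γ ++ x ++ d ++ Δ ≡ Γ ++ (x ++ d) ++ Δ
      reassoc Γ x Δ = cong (Γ ++_) (sym (++-assoc x d Δ))

  ↓-closed : Closed (↓ F)
  ↓-closed {F} {y} p =
    cast (++-identityʳ y) (p [] [] F λ {x} q → cast (sym (++-identityʳ x)) q)

  Cl-cut : Cl X [ F ] → ↓ F ⊆ Cl X
  Cl-cut p q Γ Δ C k = cut q (p Γ Δ C k)

  infixr 7 _∙_
  data _∙_ (X Y : Lang) : Lang where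
    ⟨_,_⟩ : ∀ {x y} → X x → Y y → (X ∙ Y) (x ++ y)

  _^_ : Lang → ℕ → Lang
  X ^ zero = ｛ [] ｝
  X ^ suc n = X ∙ X ^ n

  Cl-∙ : ∀ {x y} → Cl X x → Cl Y y → Cl (X ∙ Y) (x ++ y)
  Cl-∙ p q =
    Cl-least (Closed-ʳ Cl-closed) (λ px → Cl-least (Closed-ˡ Cl-closed) (λ qy → ⊆-Cl ⟨ px , qy ⟩) q) p

  replicate∈^ : X [ F ] → ∀ n → (X ^ n) (replicate n F)
  replicate∈^ p zero = refl
  replicate∈^ p (suc n) = ⟨ p , replicate∈^ p n ⟩

  ^⇒concat : ∀ n → X ^ n ⊆ (λ y → ∃[ xs ] All X xs × concat xs ≡ y)
  ^⇒concat zero refl = [] , [] , refl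
  ^⇒concat (suc n) ⟨ p , q ⟩ with ^⇒concat n q
  ... | xs , ps , refl = _ ∷ xs , p ∷ ps , refl

  ⟦_⟧ : Fm true → Lang
  ⟦ var p ⟧ = Cl ｛ [ var p ] ｝
  ⟦ 𝟘 ⟧ = Cl ∅
  ⟦ 𝟙 ⟧ = Cl ｛ [] ｝
  ⟦ A ╲ B ⟧ y = ∀ {x} → ⟦ A ⟧ x → ⟦ B ⟧ (x ++ y)
  ⟦ B ╱ A ⟧ y = ∀ {x} → ⟦ A ⟧ x → ⟦ B ⟧ (y ++ x)
  ⟦ A · B ⟧ = Cl (⟦ A ⟧ ∙ ⟦ B ⟧)
  ⟦ A ⊕ B ⟧ = Cl (⟦ A ⟧ ∪ ⟦ B ⟧)
  ⟦ A & B ⟧ = ⟦ A ⟧ ∩ ⟦ B ⟧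
  ⟦ A * ⟧ = Cl (⋃ ℕ (⟦ A ⟧ ^_))
  ⟦ ! A ⟧ = Cl (｛ [] ｝ ∩ const (⟦ A ⟧ []))

  ⟦⟧-closed : ∀ F → Closed ⟦ F ⟧
  ⟦⟧-closed (var p) = Cl-closed
  ⟦⟧-closed 𝟘 = Cl-closed
  ⟦⟧-closed 𝟙 = Cl-closed
  ⟦⟧-closed (A ╲ B) p px = Cl-least (Closed-ˡ (⟦⟧-closed B)) (λ f → f px) p
  ⟦⟧-closed (B ╱ A) p px = Cl-least (Closed-ʳ (⟦⟧-closed B)) (λ f → f px) p
  ⟦⟧-closed (A · B) = Cl-closed
  ⟦⟧-closed (A ⊕ B) = Cl-closed
  ⟦⟧-closed (A & B) p =
    ⟦⟧-closed A (Cl-mono (λ (q , _) → q) p) , ⟦⟧-closed B (Cl-mono (λ (_ , q) → q) p)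
  ⟦⟧-closed (A *) = Cl-closed
  ⟦⟧-closed (! A) = Cl-closed

  ⟦_⟧ᶜ : List (Fm true) → Lang
  ⟦ [] ⟧ᶜ = ｛ [] ｝
  ⟦ F ∷ Γ ⟧ᶜ = ⟦ F ⟧ ∙ ⟦ Γ ⟧ᶜ

  ⟦⟧ᶜ-++⁻ : ∀ Γ {Δ} → ⟦ Γ ++ Δ ⟧ᶜ ⊆ ⟦ Γ ⟧ᶜ ∙ ⟦ Δ ⟧ᶜ
  ⟦⟧ᶜ-++⁻ [] p = ⟨ refl , p ⟩
  ⟦⟧ᶜ-++⁻ (F ∷ Γ) {Δ} (⟨_,_⟩ {x} p q) with ⟦⟧ᶜ-++⁻ Γ q
  ... | ⟨_,_⟩ {y} {z} q₁ q₂ = subst (⟦ F ∷ Γ ⟧ᶜ ∙ ⟦ Δ ⟧ᶜ) (++-assoc x y z) ⟨ ⟨ p , q₁ ⟩ , q₂ ⟩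

  ⟦⟧ᶜ-++⁺ : ∀ Γ {Δ x y} → ⟦ Γ ⟧ᶜ x → ⟦ Δ ⟧ᶜ y → ⟦ Γ ++ Δ ⟧ᶜ (x ++ y)
  ⟦⟧ᶜ-++⁺ [] refl q = q
  ⟦⟧ᶜ-++⁺ (F ∷ Γ) {Δ} {y = z} (⟨_,_⟩ {x} {y} p₁ p₂) q =
    subst ⟦ (F ∷ Γ) ++ Δ ⟧ᶜ (sym (++-assoc x y z)) ⟨ p₁ , ⟦⟧ᶜ-++⁺ Γ p₂ q ⟩

  ^⊆⟦replicate⟧ᶜ : ∀ {G : Fm true} n → ⟦ G ⟧ ^ n ⊆ ⟦ replicate n G ⟧ᶜ
  ^⊆⟦replicate⟧ᶜ zero p = p
  ^⊆⟦replicate⟧ᶜ (suc n) ⟨ p , q ⟩ = ⟨ p , ^⊆⟦replicate⟧ᶜ n q ⟩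

  ⟦map!⟧ᶜ⁺ : ∀ {Γ} → All (λ G → ⟦ G ⟧ []) Γ → ⟦ map !_ Γ ⟧ᶜ []
  ⟦map!⟧ᶜ⁺ [] = refl
  ⟦map!⟧ᶜ⁺ (p ∷ ps) = ⟨ ⊆-Cl (refl , p) , ⟦map!⟧ᶜ⁺ ps ⟩

  ⟦map!⟧ᶜ⁻ : ∀ Γ → ⟦ map !_ Γ ⟧ᶜ ⊆ Cl (｛ [] ｝ ∩ const (All (λ G → ⟦ G ⟧ []) Γ))
  ⟦map!⟧ᶜ⁻ [] refl = ⊆-Cl (refl , [])
  ⟦map!⟧ᶜ⁻ (G ∷ Γ) ⟨ p , q ⟩ =
    Cl-mono (λ { ⟨ (refl , pG) , (refl , ps) ⟩ → refl , pG ∷ ps }) (Cl-∙ p (⟦map!⟧ᶜ⁻ Γ q))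

  ⟦⟧ᶜ-insert : ∀ Π {Δ F y} → ⟦ Π ++ Δ ⟧ᶜ y → ⟦ F ⟧ [] → ⟦ Π ++ F ∷ Δ ⟧ᶜ y
  ⟦⟧ᶜ-insert [] q p = ⟨ p , q ⟩
  ⟦⟧ᶜ-insert (_ ∷ Π) ⟨ q , r ⟩ p = ⟨ q , ⟦⟧ᶜ-insert Π r p ⟩

  left-rule-sound : ∀ Γ {Δ F X} → Closed Z → ⟦ F ⟧ ⊆ Cl X →
    (∀ {a x b} → ⟦ Γ ⟧ᶜ a → X x → ⟦ Δ ⟧ᶜ b → Z (a ++ x ++ b)) →
    ⟦ Γ ++ F ∷ Δ ⟧ᶜ ⊆ Z
  left-rule-sound Γ cZ generated k v with ⟦⟧ᶜ-++⁻ Γ v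
  ... | ⟨_,_⟩ {a} a′ (⟨_,_⟩ {f} {b} f′ b′) =
    Cl-least (Closed-ʳ {d = b} (Closed-ˡ {g = a} cZ)) (λ q → k a′ q b′) (generated f′)

  mutual
    sound : ∀ {Γ C} → Der true [] Γ C → ⟦ Γ ⟧ᶜ ⊆ ⟦ C ⟧
    sound (hyp ())
    sound (ax {A = A}) (⟨_,_⟩ {x} p refl) = subst ⟦ A ⟧ (sym (++-identityʳ x)) p
    sound 𝟙R refl = ⊆-Cl refl
    sound (𝟘L {Γ = Γ} {C = C}) = left-rule-sound Γ (⟦⟧-closed C) id λ _ ()
    sound *R₀ refl = ⊆-Cl (0 , refl)
    sound (╲L {Π = Π} {Γ} {C = C} d e) v with ⟦⟧ᶜ-++⁻ Γ v
    ... | ⟨_,_⟩ {a} a′ r with ⟦⟧ᶜ-++⁻ Π r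
    ... | ⟨_,_⟩ {p} p′ (⟨_,_⟩ {f} {b} f′ b′) =
      subst ⟦ C ⟧ (cong (a ++_) (++-assoc p f b))
        (sound e (⟦⟧ᶜ-++⁺ Γ a′ ⟨ f′ (sound d p′) , b′ ⟩))
    sound (╲R d) v p = sound d ⟨ p , v ⟩
    sound (╱L {Π = Π} {Γ} {C = C} d e) v with ⟦⟧ᶜ-++⁻ Γ v
    ... | ⟨_,_⟩ {a} a′ (⟨_,_⟩ {f} f′ r) with ⟦⟧ᶜ-++⁻ Π r
    ... | ⟨_,_⟩ {p} {b} p′ b′ =
      subst ⟦ C ⟧ (cong (a ++_) (++-assoc f p b))
        (sound e (⟦⟧ᶜ-++⁺ Γ a′ ⟨ f′ (sound d p′) , b′ ⟩))
    sound (╱R {Π = Π} {B = B} d) {y} v {x} p =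
      subst ⟦ B ⟧ (cong (y ++_) (++-identityʳ x)) (sound d (⟦⟧ᶜ-++⁺ Π v ⟨ p , refl ⟩))
    sound (·L {Γ = Γ} {C = C} d) = left-rule-sound Γ (⟦⟧-closed C) id
      λ { {a} {_} {b} a′ (⟨_,_⟩ {x} {y} p q) b′ →
          subst ⟦ C ⟧ (cong (a ++_) (sym (++-assoc x y b)))
            (sound d (⟦⟧ᶜ-++⁺ Γ a′ ⟨ p , ⟨ q , b′ ⟩ ⟩)) }
    sound (·R {Γ = Γ} d e) v with ⟦⟧ᶜ-++⁻ Γ v
    ... | ⟨ a , b ⟩ = ⊆-Cl ⟨ sound d a , sound e b ⟩
    sound (𝟙L {Γ = Γ} {C = C} d) = left-rule-sound Γ (⟦⟧-closed C) id
      λ { a refl b → sound d (⟦⟧ᶜ-++⁺ Γ a b) }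
    sound (⊕L {Γ = Γ} {C = C} d e) = left-rule-sound Γ (⟦⟧-closed C) id
      λ { a (inj₁ p) b → sound d (⟦⟧ᶜ-++⁺ Γ a ⟨ p , b ⟩)
        ; a (inj₂ p) b → sound e (⟦⟧ᶜ-++⁺ Γ a ⟨ p , b ⟩) }
    sound (⊕R₁ d) v = ⊆-Cl (inj₁ (sound d v))
    sound (⊕R₂ d) v = ⊆-Cl (inj₂ (sound d v))
    sound (&L₁ {Γ = Γ} {C = C} d) = left-rule-sound Γ (⟦⟧-closed C) (λ (p , _) → ⊆-Cl p)
      λ a p b → sound d (⟦⟧ᶜ-++⁺ Γ a ⟨ p , b ⟩)
    sound (&L₂ {Γ = Γ} {C = C} d) = left-rule-sound Γ (⟦⟧-closed C) (λ (_ , p) → ⊆-Cl p)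
      λ a p b → sound d (⟦⟧ᶜ-++⁺ Γ a ⟨ p , b ⟩)
    sound (&R d e) v = sound d v , sound e v
    sound (*Lω {Γ = Γ} {A = A} {C} f) = left-rule-sound Γ (⟦⟧-closed C) id
      λ { a (n , p) b → sound (f n) (⟦⟧ᶜ-++⁺ Γ a (⟦⟧ᶜ-++⁺ (replicate n A) (^⊆⟦replicate⟧ᶜ n p) b)) }
    sound (*Rₙ Π₁ Πs d ds) v with ⟦⟧ᶜ-++⁻ Π₁ v
    ... | ⟨ a , b ⟩ with sound-concat ds b
    ... | n , p = ⊆-Cl (suc n , ⟨ sound d a , p ⟩)
    sound (cut {Π = Π} {Γ} d e) v with ⟦⟧ᶜ-++⁻ Γ v
    ... | ⟨ a , r ⟩ with ⟦⟧ᶜ-++⁻ Π r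
    ... | ⟨ p , b ⟩ = sound e (⟦⟧ᶜ-++⁺ Γ a ⟨ sound d p , b ⟩)
    sound (!L {Γ = Γ} {C = C} d) = left-rule-sound Γ (⟦⟧-closed C) id
      λ { a (refl , p) b → sound d (⟦⟧ᶜ-++⁺ Γ a ⟨ p , b ⟩) }
    sound (!R {Γ = Γ} d) v =
      Cl-mono (λ { (refl , ps) → refl , sound d (⟦map!⟧ᶜ⁺ ps) }) (⟦map!⟧ᶜ⁻ Γ v)
    sound (!P₁ {Γ = Γ} {Π} {C = C} d) = left-rule-sound Γ (⟦⟧-closed C) id
      λ { a (refl , p) r → sound d (⟦⟧ᶜ-++⁺ Γ a (⟦⟧ᶜ-insert Π r (⊆-Cl (refl , p)))) }
    sound (!P₂ {Γ = Γ} {Π} {C = C} d) v with ⟦⟧ᶜ-++⁻ Γ v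
    ... | ⟨_,_⟩ {a} a′ r = left-rule-sound Π (Closed-ˡ {g = a} (⟦⟧-closed C)) id
      (λ { p (refl , q) b → sound d (⟦⟧ᶜ-++⁺ Γ a′ ⟨ ⊆-Cl (refl , q) , ⟦⟧ᶜ-++⁺ Π p b ⟩) }) r
    sound (!W {Γ = Γ} {C = C} d) = left-rule-sound Γ (⟦⟧-closed C) id
      λ { a (refl , _) b → sound d (⟦⟧ᶜ-++⁺ Γ a b) }
    sound (!C {Γ = Γ} {C = C} d) = left-rule-sound Γ (⟦⟧-closed C) id
      λ { a (refl , p) b → sound d (⟦⟧ᶜ-++⁺ Γ a ⟨ ⊆-Cl (refl , p) , ⟨ ⊆-Cl (refl , p) , b ⟩ ⟩) }

    sound-concat : ∀ {Πs A} → All (λ Π → Der true [] Π A) Πs → ⟦ concat Πs ⟧ᶜ ⊆ ⋃ ℕ (⟦ A ⟧ ^_)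
    sound-concat [] refl = 0 , refl
    sound-concat {Π ∷ _} (d ∷ ds) v with ⟦⟧ᶜ-++⁻ Π v
    ... | ⟨ a , b ⟩ with sound-concat ds b
    ... | n , p = suc n , ⟨ sound d a , p ⟩

  Der-trans : ∀ {y} → Der false S y F → Der false S [ F ] G → Der false S y G
  Der-trans {y = y} d e = cast (++-identityʳ y) (cut {Γ = []} {Δ = []} d e)

  mutual
    ↓⊆⟦emb⟧ : ∀ A → ↓ A ⊆ ⟦ emb A ⟧
    ↓⊆⟦emb⟧ (var p) = Cl-cut λ Γ Δ C k → k refl
    ↓⊆⟦emb⟧ 𝟘 = Cl-cut λ Γ Δ C k → 𝟘L
    ↓⊆⟦emb⟧ 𝟙 = Cl-cut λ Γ Δ C k → 𝟙L (k refl)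
    ↓⊆⟦emb⟧ (A ╲ B) {y} d {x} p = ↓⊆⟦emb⟧ B
      (cast (cong (x ++_) (++-identityʳ y))
        (cut {Γ = x} {Δ = []} d (╲L {Γ = []} {Δ = []} (⟦emb⟧⊆↓ A p) ax)))
    ↓⊆⟦emb⟧ (B ╱ A) {y} d {x} p = ↓⊆⟦emb⟧ B
      (cut {Γ = []} {Δ = x} d
        (cast (cong (B ╱ A ∷_) (++-identityʳ x)) (╱L {Γ = []} {Δ = []} (⟦emb⟧⊆↓ A p) ax)))
    ↓⊆⟦emb⟧ (A · B) = Cl-cut λ Γ Δ C k → ·L (k ⟨ ↓⊆⟦emb⟧ A ax , ↓⊆⟦emb⟧ B ax ⟩)
    ↓⊆⟦emb⟧ (A ⊕ B) = Cl-cut λ Γ Δ C k → ⊕L (k (inj₁ (↓⊆⟦emb⟧ A ax))) (k (inj₂ (↓⊆⟦emb⟧ B ax)))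
    ↓⊆⟦emb⟧ (A & B) d =
      ↓⊆⟦emb⟧ A (Der-trans d (&L₁ {Γ = []} {Δ = []} ax)) ,
      ↓⊆⟦emb⟧ B (Der-trans d (&L₂ {Γ = []} {Δ = []} ax))
    ↓⊆⟦emb⟧ (A *) = Cl-cut λ Γ Δ C k → *Lω λ n → k (n , replicate∈^ (↓⊆⟦emb⟧ A ax) n)

    ⟦emb⟧⊆↓ : ∀ A → ⟦ emb A ⟧ ⊆ ↓ A
    ⟦emb⟧⊆↓ (var p) = Cl-least ↓-closed λ { refl → ax }
    ⟦emb⟧⊆↓ 𝟘 = Cl-least ↓-closed λ ()
    ⟦emb⟧⊆↓ 𝟙 = Cl-least ↓-closed λ { refl → 𝟙R }
    ⟦emb⟧⊆↓ (A ╲ B) p = ╲R (⟦emb⟧⊆↓ B (p (↓⊆⟦emb⟧ A ax)))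
    ⟦emb⟧⊆↓ (B ╱ A) p = ╱R (⟦emb⟧⊆↓ B (p (↓⊆⟦emb⟧ A ax)))
    ⟦emb⟧⊆↓ (A · B) = Cl-least ↓-closed λ { ⟨ p , q ⟩ → ·R (⟦emb⟧⊆↓ A p) (⟦emb⟧⊆↓ B q) }
    ⟦emb⟧⊆↓ (A ⊕ B) = Cl-least ↓-closed
      λ { (inj₁ p) → ⊕R₁ (⟦emb⟧⊆↓ A p) ; (inj₂ q) → ⊕R₂ (⟦emb⟧⊆↓ B q) }
    ⟦emb⟧⊆↓ (A & B) (p , q) = &R (⟦emb⟧⊆↓ A p) (⟦emb⟧⊆↓ B q)
    ⟦emb⟧⊆↓ (A *) = Cl-least ↓-closed λ (n , p) → star (^⇒concat n p)
      where
        star : ∀ {y} → ∃[ xs ] All ⟦ emb A ⟧ xs × concat xs ≡ y → Der false S y (A *)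
        star (_ , ps , refl) = *R (All.map (⟦emb⟧⊆↓ A) ps)

  ⟦map-emb⟧ᶜ : ∀ Π → ⟦ map emb Π ⟧ᶜ Π
  ⟦map-emb⟧ᶜ [] = refl
  ⟦map-emb⟧ᶜ (A ∷ Π) = ⟨ ↓⊆⟦emb⟧ A ax , ⟦map-emb⟧ᶜ Π ⟩

  eliminate-valid-! : ∀ {Γ Π C} → All (λ G → ⟦ G ⟧ []) Γ →
                      Der true [] (map !_ Γ ++ map emb Π) (emb C) → Der false S Π C
  eliminate-valid-! {Γ} {Π} {C} valid d =
    ⟦emb⟧⊆↓ C (sound d (⟦⟧ᶜ-++⁺ (map !_ Γ) (⟦map!⟧ᶜ⁺ valid) (⟦map-emb⟧ᶜ Π)))

  Υ-valid : All (λ G → ⟦ G ⟧ []) (map emb (Υ S))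
  Υ-valid = All-map⁺ (All-map⁺ (tabulate λ m → ↓⊆⟦emb⟧ _ (υ-R (hyp m))))

theorem2p6 : (S : List (Seq false)) (Π : List (Fm false)) (C : Fm false) →
    Der false S Π C ⇔ Der true [] (map (λ A → ! emb A) (Υ S) ++ map emb Π) (emb C)
theorem2p6 S Π C =
  subst (λ Θ → Der false S Π C ⇔ Der true [] (Θ ++ map emb Π) (emb C)) (sym (map-∘ (Υ S)))
    (mk⇔ (Simulation.embed (map emb (Υ S)) hyp-from-!Υ)
         (PhaseModel.eliminate-valid-! S (PhaseModel.Υ-valid S)))
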